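{- Let $G$ be a graph, $X\subseteq V(G)$, and let $(A,B)$ be a split pair for $X$. If $v,w\in X$ satisfy $N(v)\cap B=N(w)\cap B$, then $v\approx_X w$. Similarly, if $v',w'\in\overline X$ satisfy $N(v')\cap A=N(w')\cap A$, then $v'\approx_{\overline X}w'$.
   Context: Graphs are finite, simple, undirected; $N(v)$ is the neighbourhood of $v$ and $\overline X=V(G)\setminus X$. For $v,w\in X$, $v\approx_X w$ means $N(v)\cap\overline X=N(w)\cap\overline X$. For $v\in X$, $\mathbf x_X(v)\in\mathbb F_2^{\overline X}$ has $w$-entry $1$ iff $vw\in E(G)$, and $\mathbf x_X(S)=\{\mathbf x_X(v)\mid v\in S\}$. A pair $(A,B)$ is a split pair for $X$ if $A\subseteq X$, $B\subseteq\overline X$, $\mathbf x_X(A)$ is a linear basis of the $\mathbb F_2$-span of $\mathbf x_X(X)$, and $\mathbf x_{\overline X}(B)$ is a linear basis of the span of $\mathbf x_{\overline X}(\overline X)$ (for $X=V(G)$, $(\emptyset,\emptyset)$ is a split pair). -}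

module Defs where

open import Data.Nat using (ℕ; zero; suc)
open import Data.Bool using (Bool; true; false; not; _∧_; _xor_)
open import Data.Fin using (Fin; zero; suc)
open import Data.Fin.Subset using (Subset; _∈_; _∉_; _⊆_; ∁; Empty)
open import Data.Vec using (lookup)
open import Data.Product using (_×_; Σ; ∃)
open import Relation.Binary.PropositionalEquality using (_≡_)

record Graph (n : ℕ) : Set where
  field
    adj   : Fin n → Fin n → Bool
    sym   : ∀ u v → adj u v ≡ adj v u
    irref : ∀ v → adj v v ≡ false
open Graph public

xorSum : ∀ {n} → (Fin n → Bool) → Bool
xorSum {zero}  f = false
xorSum {suc n} f = f zero xor xorSum (λ i → f (suc i))

-- x_X(v) ∈ 𝔽₂^{X̄}, represented as a function Fin n → Bool that is
-- forced to be 0 on coordinates in X (so equality of such functions is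
-- exactly equality in 𝔽₂^{X̄}).
xvec : ∀ {n} → Graph n → Subset n → Fin n → Fin n → Bool
xvec G X v w = not (lookup X w) ∧ adj G v w

comb : ∀ {n} → Graph n → Subset n → Subset n → Fin n → Bool
comb G X T w = xorSum (λ v → lookup T v ∧ xvec G X v w)

InSpan : ∀ {n} → Graph n → Subset n → Subset n → (Fin n → Bool) → Set
InSpan G X A u = Σ (Subset _) λ T → T ⊆ A × (∀ w → comb G X T w ≡ u w)

-- The SET x_X(A) is linearly independent: every subset of it (i.e. the
-- image of some T ⊆ A on which x_X is injective) with zero sum is empty.
Independent : ∀ {n} → Graph n → Subset n → Subset n → Set
Independent G X A =
  ∀ (T : Subset _) → T ⊆ A →
  (∀ v v' → v ∈ T → v' ∈ T → (∀ w → xvec G X v w ≡ xvec G X v' w) → v ≡ v') →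
  (∀ w → comb G X T w ≡ false) →
  Empty T

IsBasisFor : ∀ {n} → Graph n → Subset n → Subset n → Set
IsBasisFor G X A =
  A ⊆ X × Independent G X A × (∀ v → v ∈ X → InSpan G X A (xvec G X v))

SplitPair : ∀ {n} → Graph n → Subset n → Subset n → Subset n → Set
SplitPair G X A B = IsBasisFor G X A × IsBasisFor G (∁ X) B

Equiv : ∀ {n} → Graph n → Subset n → Fin n → Fin n → Set
Equiv G X v w = ∀ u → u ∉ X → adj G v u ≡ adj G w u

SameOn : ∀ {n} → Graph n → Subset n → Fin n → Fin n → Set
SameOn G S v w = ∀ u → u ∈ S → adj G v u ≡ adj G w u

module Submission where

-- Fix a side Y of the cut (Y = X̄ for the first claim, Y = X
-- for the second) and a set B such that every vector x_Y(u), u ∈ Y, lies in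
-- the 𝔽₂-span of x_Y(B).  For a vertex v ∉ Y the v-coordinate of x_Y(u) is
-- just adj(u,v); so the v-coordinate of a combination Σ_{b∈T} x_Y(b) with
-- T ⊆ B is Σ_{b∈T} adj(v,b), which depends only on N(v) ∩ B.  Hence, if
-- v,w ∉ Y have the same neighbours in B, every vector of the span — in
-- particular every x_Y(u) with u ∈ Y — takes equal values at v and w,
-- i.e. v and w have the same neighbours in Y.

open import Defs
open import Data.Nat using (zero; suc)
open import Data.Fin using (Fin; zero; suc)
open import Data.Fin.Subset using (Subset; _∈_; _∉_; ∁; _⊆_)
open import Data.Fin.Subset.Properties using (x∈∁p⇒x∉p; x∉∁p⇒x∈p; x∉p⇒x∈∁p; x∈p⇒x∉∁p)
open import Data.Product using (_×_; _,_)
open import Data.Bool using (Bool; true; false; _∧_; _xor_)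
open import Data.Vec using (lookup)
open import Data.Vec.Properties using (lookup⇒[]=)
open import Data.Empty using (⊥-elim)
open import Relation.Binary.PropositionalEquality using (_≡_; refl; cong₂; module ≡-Reasoning)
  renaming (sym to ≡-sym)

xorSum-cong : ∀ {n} (f g : Fin n → Bool) → (∀ i → f i ≡ g i) → xorSum f ≡ xorSum g
xorSum-cong {zero}  f g f≗g = refl
xorSum-cong {suc n} f g f≗g =
  cong₂ _xor_ (f≗g zero) (xorSum-cong (λ i → f (suc i)) (λ i → g (suc i)) (λ i → f≗g (suc i)))

lookup-∉ : ∀ {n} (Y : Subset n) v → v ∉ Y → lookup Y v ≡ false
lookup-∉ Y v v∉Y with lookup Y v in eq
... | true  = ⊥-elim (v∉Y (lookup⇒[]= v Y eq))
... | false = refl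

xvec-outside : ∀ {n} (G : Graph n) (Y : Subset n) u v → v ∉ Y → xvec G Y u v ≡ adj G v u
xvec-outside G Y u v v∉Y rewrite lookup-∉ Y v v∉Y = sym G u v

comb-respects-SameOn : ∀ {n} (G : Graph n) (Y B T : Subset n) → T ⊆ B →
  ∀ v w → v ∉ Y → w ∉ Y → SameOn G B v w → comb G Y T v ≡ comb G Y T w
comb-respects-SameOn G Y B T T⊆B v w v∉Y w∉Y sameB =
  xorSum-cong _ _ summand-eq
  where
  summand-eq : ∀ b → (lookup T b ∧ xvec G Y b v) ≡ (lookup T b ∧ xvec G Y b w)
  summand-eq b with lookup T b in b∈T
  ... | false = refl
  ... | true rewrite xvec-outside G Y b v v∉Y | xvec-outside G Y b w w∉Y =
    sameB b (T⊆B (lookup⇒[]= b T b∈T))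

sameOn-transfer : ∀ {n} (G : Graph n) (Y B : Subset n) →
  (∀ u → u ∈ Y → InSpan G Y B (xvec G Y u)) →
  ∀ v w → v ∉ Y → w ∉ Y → SameOn G B v w → SameOn G Y v w
sameOn-transfer G Y B spans v w v∉Y w∉Y sameB u u∈Y with spans u u∈Y
... | T , T⊆B , T-sums-to-u =
  begin
    adj G v u     ≡⟨ ≡-sym (xvec-outside G Y u v v∉Y) ⟩
    xvec G Y u v  ≡⟨ ≡-sym (T-sums-to-u v) ⟩
    comb G Y T v  ≡⟨ comb-respects-SameOn G Y B T T⊆B v w v∉Y w∉Y sameB ⟩
    comb G Y T w  ≡⟨ T-sums-to-u w ⟩
    xvec G Y u w  ≡⟨ xvec-outside G Y u w w∉Y ⟩
    adj G w u     ∎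
  where open ≡-Reasoning

lemma3p3 : ∀ {n} (G : Graph n) (X A B : Subset n) → SplitPair G X A B →
    (∀ v w → v ∈ X → w ∈ X → SameOn G B v w → Equiv G X v w)
    × (∀ v' w' → v' ∈ ∁ X → w' ∈ ∁ X → SameOn G A v' w' → Equiv G (∁ X) v' w')
lemma3p3 G X A B ((_ , _ , X-spanned-by-A) , (_ , _ , X̄-spanned-by-B)) =
  inside-claim , outside-claim
  where
  inside-claim : ∀ v w → v ∈ X → w ∈ X → SameOn G B v w → Equiv G X v w
  inside-claim v w v∈X w∈X sameB u u∉X =
    sameOn-transfer G (∁ X) B X̄-spanned-by-B v w
      (x∈p⇒x∉∁p v∈X) (x∈p⇒x∉∁p w∈X) sameB u (x∉p⇒x∈∁p u∉X)
  outside-claim : ∀ v w → v ∈ ∁ X → w ∈ ∁ X → SameOn G A v w → Equiv G (∁ X) v w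
  outside-claim v w v∈X̄ w∈X̄ sameA u u∉X̄ =
    sameOn-transfer G X A X-spanned-by-A v w
      (x∈∁p⇒x∉p v∈X̄) (x∈∁p⇒x∉p w∈X̄) sameA u (x∉∁p⇒x∈p u∉X̄)
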